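{- For any positive integers $n$ and $k$ with $n \ge 2k$, $$d_0(n,k)\Delta(n,k) + d_1(n,k)\Delta(n+1,k) + d_2(n,k)\Delta(n+2,k) = 0,$$ where $d_0(n,k) = (1+n)(2+n)(n-2-6k)(n-3k)$, $d_1(n,k) = (2+n)(3+12k+3k^2-18k^3+8kn+27k^2n-2n^2-10kn^2+n^3)$, $d_2(n,k) = -(1+n)(n-3-6k)(n-1-3k)(n+2-2k)$.
   Context: For integers $n \ge 1$ and $k \ge 0$, $JL_{n,k} = \sum_{i=k}^{\lfloor n/2 \rfloor} \frac{n}{n-i} \binom{n-i}{i} \binom{i}{k}$ (empty sum $=0$), and $\Delta(n,k) = JL_{n,k+1} - JL_{n,k}$. -}

module Defs where

open import Data.Nat using (ℕ; zero; suc; _+_; _*_; _∸_; _/_)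
open import Data.Nat.Combinatorics using (_C_)
open import Data.Integer using (ℤ; +_) renaming (_-_ to _-ℤ_)

-- Σ[ i = a .. b ] f i  (inclusive; empty, i.e. 0, when b < a)
-- sumFrom a len f = f a + f (a+1) + ... + f (a+len-1)
sumFrom : ℕ → ℕ → (ℕ → ℕ) → ℕ
sumFrom a zero    f = 0
sumFrom a (suc l) f = f a + sumFrom (suc a) l f

sumRange : ℕ → ℕ → (ℕ → ℕ) → ℕ
sumRange a b f = sumFrom a (suc b ∸ a) f

divN : ℕ → ℕ → ℕ
divN x zero    = 0
divN x (suc d) = x / suc d

-- n/(n-i) * C(n-i,i) : an integer for 0 ≤ i ≤ ⌊n/2⌋, n ≥ 1 (exact division)
lucasCoeff : ℕ → ℕ → ℕ
lucasCoeff n i = divN (n * ((n ∸ i) C i)) (n ∸ i)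

JL : ℕ → ℕ → ℕ
JL n k = sumRange k (n / 2) (λ i → lucasCoeff n i * (i C k))

Δ : ℕ → ℕ → ℤ
Δ n k = + JL n (suc k) -ℤ + JL n k

{-# OPTIONS --safe #-}
-- Let F_n(x) = Σ_i C(n−i,i) x^i be the Fibonacci polynomials (F_{n+2} = F_{n+1} + x F_n); the
-- Lucas polynomials L_{n+2} = F_{n+2} + x F_n have the coefficients n/(n−i) C(n−i,i), so JL n k is
-- the coefficient of y^k in L_n(1+y). Writing F n k for that of F_n(1+y), the identities
-- L_n = 2F_n − F_{n−1} and F(n+2,k+1) = F(n+1,k+1) + F(n,k) + F(n,k+1) express Δ(n,k) through the
-- single sequence b = F(·,k+1) as 3(b_n + b_{n+1}) − 2(b_{n−1} + b_{n+2}). Each F(·,k) satisfies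
-- (m − 2k) F(m,k) = (m − k) F(m−1,k) + m F(m−2,k): the residual of this recurrence obeys the same
-- Pascal rule as F, so it vanishes by induction from the base cases. The theorem is then a polynomial
-- identity writing its left-hand side as a combination of four instances of the recurrence for b.
module Submission where

open import Defs
open import Data.Nat using (ℕ; _≤_)
open import Relation.Binary.PropositionalEquality using (_≡_)

module SumFromProperties where

  open import Data.Nat
  open import Data.Nat.Properties
  open import Relation.Binary.PropositionalEquality
  open import Relation.Nullary using (yes; no)
  open import Algebra.Properties.CommutativeSemigroup +-commutativeSemigroup using (interchange)
  open ≡-Reasoning

  sumFrom-cong : ∀ a l {f g : ℕ → ℕ} → f ≗ g → sumFrom a l f ≡ sumFrom a l g
  sumFrom-cong a zero    f≗g = refl
  sumFrom-cong a (suc l) f≗g = cong₂ _+_ (f≗g a) (sumFrom-cong (suc a) l f≗g)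

  sumFrom-distrib-+ : ∀ a l (f g : ℕ → ℕ) →
    sumFrom a l (λ i → f i + g i) ≡ sumFrom a l f + sumFrom a l g
  sumFrom-distrib-+ a zero    f g = refl
  sumFrom-distrib-+ a (suc l) f g =
    trans (cong (f a + g a +_) (sumFrom-distrib-+ (suc a) l f g)) (interchange (f a) (g a) _ _)

  sumFrom-shift : ∀ a l (f : ℕ → ℕ) → sumFrom (suc a) l f ≡ sumFrom a l (λ i → f (suc i))
  sumFrom-shift a zero    f = refl
  sumFrom-shift a (suc l) f = cong (f (suc a) +_) (sumFrom-shift (suc a) l f)

  sumFrom-++ : ∀ a l m (f : ℕ → ℕ) → sumFrom a (l + m) f ≡ sumFrom a l f + sumFrom (a + l) m f
  sumFrom-++ a zero    m f = cong (λ b → sumFrom b m f) (sym (+-identityʳ a))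
  sumFrom-++ a (suc l) m f = begin
      f a + sumFrom (suc a) (l + m) f
    ≡⟨ cong (f a +_) (sumFrom-++ (suc a) l m f) ⟩
      f a + (sumFrom (suc a) l f + sumFrom (suc a + l) m f)
    ≡⟨ sym (+-assoc (f a) _ _) ⟩
      sumFrom a (suc l) f + sumFrom (suc a + l) m f
    ≡⟨ cong (λ b → sumFrom a (suc l) f + sumFrom b m f) (sym (+-suc a l)) ⟩
      sumFrom a (suc l) f + sumFrom (a + suc l) m f
    ∎

  sumFrom-vanishes : ∀ a l (f : ℕ → ℕ) → (∀ i → a ≤ i → i < a + l → f i ≡ 0) → sumFrom a l f ≡ 0
  sumFrom-vanishes a zero    f f≡0 = refl
  sumFrom-vanishes a (suc l) f f≡0 = cong₂ _+_
    (f≡0 a ≤-refl (m<m+n a z<s))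
    (sumFrom-vanishes (suc a) l f λ i a<i i<a+l →
      f≡0 i (<⇒≤ a<i) (subst (i <_) (sym (+-suc a l)) i<a+l))

  sumFrom-extend : ∀ a {l L} (f : ℕ → ℕ) → l ≤ L → (∀ i → a + l ≤ i → f i ≡ 0) →
    sumFrom a L f ≡ sumFrom a l f
  sumFrom-extend a {l} {L} f l≤L f≡0 = begin
      sumFrom a L f
    ≡⟨ cong (λ m → sumFrom a m f) (sym (m+[n∸m]≡n l≤L)) ⟩
      sumFrom a (l + (L ∸ l)) f
    ≡⟨ sumFrom-++ a l (L ∸ l) f ⟩
      sumFrom a l f + sumFrom (a + l) (L ∸ l) f
    ≡⟨ cong (sumFrom a l f +_) (sumFrom-vanishes (a + l) (L ∸ l) f (λ i a+l≤i _ → f≡0 i a+l≤i)) ⟩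
      sumFrom a l f + 0
    ≡⟨ +-identityʳ _ ⟩
      sumFrom a l f
    ∎

  sumRange-as-prefix : ∀ a b L (f : ℕ → ℕ) → (∀ i → i < a → f i ≡ 0) → (∀ i → b < i → f i ≡ 0) →
    b < L → sumRange a b f ≡ sumFrom 0 L f
  sumRange-as-prefix a b L f below above b<L with a ≤? suc b
  ... | yes a≤1+b = sym (begin
      sumFrom 0 L f
    ≡⟨ sumFrom-extend 0 f b<L above ⟩
      sumFrom 0 (suc b) f
    ≡⟨ cong (λ m → sumFrom 0 m f) (sym (m+[n∸m]≡n a≤1+b)) ⟩
      sumFrom 0 (a + (suc b ∸ a)) f
    ≡⟨ sumFrom-++ 0 a (suc b ∸ a) f ⟩
      sumFrom 0 a f + sumRange a b f
    ≡⟨ cong (_+ sumRange a b f) (sumFrom-vanishes 0 a f (λ i _ → below i)) ⟩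
      sumRange a b f
    ∎)
  ... | no a≰1+b = begin
      sumRange a b f
    ≡⟨ cong (λ m → sumFrom a m f) (m≤n⇒m∸n≡0 (<⇒≤ 1+b<a)) ⟩
      0
    ≡⟨ sym (sumFrom-vanishes 0 (suc b) f (λ i _ i<1+b → below i (<-trans i<1+b 1+b<a))) ⟩
      sumFrom 0 (suc b) f
    ≡⟨ sym (sumFrom-extend 0 f b<L above) ⟩
      sumFrom 0 L f
    ∎
    where
    1+b<a : suc b < a
    1+b<a = ≰⇒> a≰1+b

module FibonacciLucas where

  open import Data.Nat
  open import Data.Nat.Properties
  open import Data.Nat.DivMod using (m*n/n≡m; n/n≡1; m/n≤m; /-monoˡ-≤)
  open import Data.Nat.Combinatorics using (_C_; nC1≡n; nCk+nC[k+1]≡[n+1]C[k+1]; k>n⇒nCk≡0)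
  open import Relation.Binary.PropositionalEquality
  open import Relation.Nullary using (yes; no)
  open ≡-Reasoning
  open SumFromProperties

  [k+1]*[n+1]C[k+1]≡[n+1]*nCk : ∀ n k → suc k * (suc n C suc k) ≡ suc n * (n C k)
  [k+1]*[n+1]C[k+1]≡[n+1]*nCk zero    zero    = refl
  [k+1]*[n+1]C[k+1]≡[n+1]*nCk zero    (suc k) = *-zeroʳ (2 + k)
  [k+1]*[n+1]C[k+1]≡[n+1]*nCk (suc n) zero    =
    trans (*-identityˡ _) (trans (nC1≡n (2 + n)) (sym (*-identityʳ (2 + n))))
  [k+1]*[n+1]C[k+1]≡[n+1]*nCk (suc n) (suc k) = begin
      suc j * (suc m C suc j)
    ≡⟨ cong (suc j *_) (sym (nCk+nC[k+1]≡[n+1]C[k+1] m j)) ⟩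
      suc j * (m C j + m C suc j)
    ≡⟨ *-distribˡ-+ (suc j) (m C j) (m C suc j) ⟩
      m C j + j * (m C j) + suc j * (m C suc j)
    ≡⟨ cong₂ (λ a b → m C j + a + b) ([k+1]*[n+1]C[k+1]≡[n+1]*nCk n k) ([k+1]*[n+1]C[k+1]≡[n+1]*nCk n j) ⟩
      m C j + m * (n C k) + m * (n C j)
    ≡⟨ +-assoc (m C j) _ _ ⟩
      m C j + (m * (n C k) + m * (n C j))
    ≡⟨ cong (m C j +_) (sym (*-distribˡ-+ m (n C k) (n C j))) ⟩
      m C j + m * (n C k + n C j)
    ≡⟨ cong (λ a → m C j + m * a) (nCk+nC[k+1]≡[n+1]C[k+1] n k) ⟩
      suc m * (m C j)
    ∎
    where
    m j : ℕ
    m = suc n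
    j = suc k

  m/n<o⇒m<o*n : ∀ {m n o} .{{_ : NonZero n}} → m / n < o → m < o * n
  m/n<o⇒m<o*n {m} {n} {o} m/n<o = ≰⇒> λ o*n≤m →
    <⇒≱ m/n<o (subst (_≤ m / n) (m*n/n≡m o n) (/-monoˡ-≤ n o*n≤m))

  divN-zeroˡ : ∀ d → divN 0 d ≡ 0
  divN-zeroˡ zero    = refl
  divN-zeroˡ (suc d) = refl

  fibCoeff : ℕ → ℕ → ℕ
  fibCoeff n i = (n ∸ i) C i

  mulX : (ℕ → ℕ) → ℕ → ℕ
  mulX c zero    = 0
  mulX c (suc i) = c i

  fibCoeff-vanishes : ∀ {n i} → n < i → fibCoeff n i ≡ 0
  fibCoeff-vanishes {n} {i} n<i = k>n⇒nCk≡0 (≤-<-trans (m∸n≤m n i) n<i)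

  mulX-fibCoeff-vanishes : ∀ {n i} → suc n < i → mulX (fibCoeff n) i ≡ 0
  mulX-fibCoeff-vanishes {i = suc i} (s≤s n<i) = fibCoeff-vanishes n<i

  fibCoeff-pascal : ∀ n i → fibCoeff (2 + n) i ≡ fibCoeff (1 + n) i + mulX (fibCoeff n) i
  fibCoeff-pascal n zero    = refl
  fibCoeff-pascal n (suc j) with j ≤? n
  ... | yes j≤n rewrite +-∸-assoc 1 j≤n =
    trans (sym (nCk+nC[k+1]≡[n+1]C[k+1] (n ∸ j) j)) (+-comm ((n ∸ j) C j) _)
  ... | no j≰n rewrite m≤n⇒m∸n≡0 (≰⇒> j≰n) | m≤n⇒m∸n≡0 (<⇒≤ (≰⇒> j≰n)) =
    sym (k>n⇒nCk≡0 (≤-<-trans z≤n (≰⇒> j≰n)))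

  m/2<n⇒m∸n<n : ∀ {m n} → m / 2 < n → m ∸ n < n
  m/2<n⇒m∸n<n {m} {suc n} m/2<n =
    m<n+o⇒m∸n<o m (suc n) (subst (m <_) 2[1+n]≡[1+n]+[1+n] (m/n<o⇒m<o*n m/2<n))
    where
    2[1+n]≡[1+n]+[1+n] : suc n * 2 ≡ suc n + suc n
    2[1+n]≡[1+n]+[1+n] = trans (*-comm (suc n) 2) (cong (suc n +_) (+-identityʳ (suc n)))

  lucasCoeff-vanishes : ∀ {m i} → m / 2 < i → lucasCoeff m i ≡ 0
  lucasCoeff-vanishes {m} {i} m/2<i = begin
      divN (m * ((m ∸ i) C i)) (m ∸ i)
    ≡⟨ cong (λ c → divN (m * c) (m ∸ i)) (k>n⇒nCk≡0 (m/2<n⇒m∸n<n m/2<i)) ⟩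
      divN (m * 0) (m ∸ i)
    ≡⟨ cong (λ a → divN a (m ∸ i)) (*-zeroʳ m) ⟩
      divN 0 (m ∸ i)
    ≡⟨ divN-zeroˡ (m ∸ i) ⟩
      0
    ∎

  lucasCoeff-decomp : ∀ n i → lucasCoeff (2 + n) i ≡ fibCoeff (2 + n) i + mulX (fibCoeff n) i
  lucasCoeff-decomp n zero = trans (cong (_/ (2 + n)) (*-identityʳ (2 + n))) (n/n≡1 (2 + n))
  lucasCoeff-decomp n (suc j) with j ≤? n
  ... | yes j≤n rewrite +-∸-assoc 1 j≤n = begin
      (2 + n) * X / suc m
    ≡⟨ cong (λ a → a * X / suc m) 2+n≡[1+m]+[1+j] ⟩
      (suc m + suc j) * X / suc m
    ≡⟨ cong (_/ suc m) (*-distribʳ-+ X (suc m) (suc j)) ⟩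
      (suc m * X + suc j * X) / suc m
    ≡⟨ cong (λ a → (suc m * X + a) / suc m) ([k+1]*[n+1]C[k+1]≡[n+1]*nCk m j) ⟩
      (suc m * X + suc m * (m C j)) / suc m
    ≡⟨ cong (_/ suc m) (trans (sym (*-distribˡ-+ (suc m) X (m C j))) (*-comm (suc m) _)) ⟩
      (X + m C j) * suc m / suc m
    ≡⟨ m*n/n≡m (X + m C j) (suc m) ⟩
      X + m C j
    ∎
    where
    m X : ℕ
    m = n ∸ j
    X = suc m C suc j
    2+n≡[1+m]+[1+j] : 2 + n ≡ suc m + suc j
    2+n≡[1+m]+[1+j] = cong suc (trans (cong suc (sym (m∸n+n≡m j≤n))) (sym (+-suc m j)))
  ... | no j≰n rewrite m≤n⇒m∸n≡0 (≰⇒> j≰n) | m≤n⇒m∸n≡0 (<⇒≤ (≰⇒> j≰n)) =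
    sym (k>n⇒nCk≡0 (≤-<-trans z≤n (≰⇒> j≰n)))

  -- coeffSum c L k is the coefficient of y^k in Σ_{i<L} c i (1+y)^i.
  coeffSum : (ℕ → ℕ) → ℕ → ℕ → ℕ
  coeffSum c L k = sumFrom 0 L (λ i → c i * (i C k))

  coeffSum-split : ∀ {c} (a b : ℕ → ℕ) L k → (∀ i → c i ≡ a i + b i) →
    coeffSum c L k ≡ coeffSum a L k + coeffSum b L k
  coeffSum-split a b L k c≡a+b = trans
    (sumFrom-cong 0 L λ i → trans (cong (_* (i C k)) (c≡a+b i)) (*-distribʳ-+ (i C k) (a i) (b i)))
    (sumFrom-distrib-+ 0 L _ _)

  coeffSum-extend : ∀ (c : ℕ → ℕ) l {L} k → l ≤ L → (∀ i → l ≤ i → c i ≡ 0) →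
    coeffSum c L k ≡ coeffSum c l k
  coeffSum-extend c l k l≤L c≡0 = sumFrom-extend 0 _ l≤L λ i l≤i → cong (_* (i C k)) (c≡0 i l≤i)

  coeffSum-mulX-zero : ∀ c L → coeffSum (mulX c) (suc L) 0 ≡ coeffSum c L 0
  coeffSum-mulX-zero c L = sumFrom-shift 0 L _

  coeffSum-mulX-suc : ∀ c L k → coeffSum (mulX c) (suc L) (suc k) ≡ coeffSum c L k + coeffSum c L (suc k)
  coeffSum-mulX-suc c L k = begin
      sumFrom 1 L (λ i → mulX c i * (i C suc k))
    ≡⟨ sumFrom-shift 0 L _ ⟩
      sumFrom 0 L (λ i → c i * (suc i C suc k))
    ≡⟨ sumFrom-cong 0 L (λ i → trans (cong (c i *_) (sym (nCk+nC[k+1]≡[n+1]C[k+1] i k)))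
                                      (*-distribˡ-+ (c i) (i C k) (i C suc k))) ⟩
      sumFrom 0 L (λ i → c i * (i C k) + c i * (i C suc k))
    ≡⟨ sumFrom-distrib-+ 0 L _ _ ⟩
      coeffSum c L k + coeffSum c L (suc k)
    ∎

  JL-as-coeffSum : ∀ n k → JL n k ≡ coeffSum (lucasCoeff n) (suc n) k
  JL-as-coeffSum n k = sumRange-as-prefix k (n / 2) (suc n) _
    (λ i i<k → trans (cong (lucasCoeff n i *_) (k>n⇒nCk≡0 i<k)) (*-zeroʳ (lucasCoeff n i)))
    (λ i n/2<i → cong (_* (i C k)) (lucasCoeff-vanishes n/2<i))
    (s≤s (m/n≤m n 2))

  F xF : ℕ → ℕ → ℕ
  F n  = coeffSum (fibCoeff n) (suc n)
  xF n = coeffSum (mulX (fibCoeff n)) (2 + n)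

  F-pascal : ∀ n k → F (2 + n) k ≡ F (1 + n) k + xF n k
  F-pascal n k = begin
      F (2 + n) k
    ≡⟨ coeffSum-split (fibCoeff (1 + n)) (mulX (fibCoeff n)) (3 + n) k (fibCoeff-pascal n) ⟩
      coeffSum (fibCoeff (1 + n)) (3 + n) k + coeffSum (mulX (fibCoeff n)) (3 + n) k
    ≡⟨ cong₂ _+_ (coeffSum-extend _ (2 + n) k (n≤1+n _) (λ _ → fibCoeff-vanishes))
                 (coeffSum-extend _ (2 + n) k (n≤1+n _) (λ _ → mulX-fibCoeff-vanishes)) ⟩
      F (1 + n) k + xF n k
    ∎

  JL-decomp : ∀ n k → JL (2 + n) k ≡ F (2 + n) k + xF n k
  JL-decomp n k = begin
      JL (2 + n) k
    ≡⟨ JL-as-coeffSum (2 + n) k ⟩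
      coeffSum (lucasCoeff (2 + n)) (3 + n) k
    ≡⟨ coeffSum-split (fibCoeff (2 + n)) (mulX (fibCoeff n)) (3 + n) k (lucasCoeff-decomp n) ⟩
      F (2 + n) k + coeffSum (mulX (fibCoeff n)) (3 + n) k
    ≡⟨ cong (F (2 + n) k +_) (coeffSum-extend _ (2 + n) k (n≤1+n _) (λ _ → mulX-fibCoeff-vanishes)) ⟩
      F (2 + n) k + xF n k
    ∎

  F-pascal-zero : ∀ n → F (2 + n) 0 ≡ F (1 + n) 0 + F n 0
  F-pascal-zero n =
    trans (F-pascal n 0) (cong (F (1 + n) 0 +_) (coeffSum-mulX-zero (fibCoeff n) (suc n)))

  F-pascal-suc : ∀ n k → F (2 + n) (suc k) ≡ F (1 + n) (suc k) + (F n k + F n (suc k))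
  F-pascal-suc n k =
    trans (F-pascal n (suc k)) (cong (F (1 + n) (suc k) +_) (coeffSum-mulX-suc (fibCoeff n) (suc n) k))

open FibonacciLucas using (F; xF; F-pascal; F-pascal-zero; F-pascal-suc; JL-decomp)

open import Data.Integer using (ℤ; +_; _+_; _-_; _*_; -_)
import Data.Nat as ℕ
open import Data.Nat.Properties using (≤-trans; *-monoʳ-≤)
open import Data.Integer.Tactic.RingSolver using (solve-∀)
open import Relation.Binary.PropositionalEquality using (refl; sym; trans; cong; cong₂; module ≡-Reasoning)
open import Relation.Nullary using (contradiction)
open ≡-Reasoning

JL-via-F : ∀ n k → + JL (2 ℕ.+ n) k ≡ + 2 * + F (2 ℕ.+ n) k - + F (1 ℕ.+ n) k
JL-via-F n k = begin
    + JL (2 ℕ.+ n) k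
  ≡⟨ cong +_ (JL-decomp n k) ⟩
    + F (2 ℕ.+ n) k + X
  ≡⟨ cong (λ a → a + X) (cong +_ (F-pascal n k)) ⟩
    A + X + X
  ≡⟨ identity A X ⟩
    + 2 * (A + X) - A
  ≡⟨ cong (λ a → + 2 * a - A) (cong +_ (sym (F-pascal n k))) ⟩
    + 2 * + F (2 ℕ.+ n) k - A
  ∎
  where
  A X : ℤ
  A = + F (1 ℕ.+ n) k
  X = + xF n k
  identity : ∀ a x → a + x + x ≡ + 2 * (a + x) - a
  identity = solve-∀

F-via-next-level : ∀ n k → + F n k ≡ + F (2 ℕ.+ n) (ℕ.suc k) - + F (1 ℕ.+ n) (ℕ.suc k) - + F n (ℕ.suc k)
F-via-next-level n k = begin
    + F n k
  ≡⟨ identity (+ F n k) B C ⟩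
    B + (+ F n k + C) - B - C
  ≡⟨ cong (λ a → a - B - C) (cong +_ (sym (F-pascal-suc n k))) ⟩
    + F (2 ℕ.+ n) (ℕ.suc k) - B - C
  ∎
  where
  B C : ℤ
  B = + F (1 ℕ.+ n) (ℕ.suc k)
  C = + F n (ℕ.suc k)
  identity : ∀ a b c → a ≡ b + (a + c) - b - c
  identity = solve-∀

-- The ring solver treats defined names as atoms; INLINE lets it see through these abbreviations.
δ : ℤ → ℤ → ℤ → ℤ → ℤ
δ w x y z = + 3 * (x + y) - + 2 * (w + z)
{-# INLINE δ #-}

Δ-via-F : ∀ n k → let b = λ i → + F (i ℕ.+ n) (ℕ.suc k) in Δ (2 ℕ.+ n) k ≡ δ (b 1) (b 2) (b 3) (b 4)
Δ-via-F n k = begin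
    + JL (2 ℕ.+ n) (ℕ.suc k) - + JL (2 ℕ.+ n) k
  ≡⟨ cong₂ _-_ (JL-via-F n (ℕ.suc k)) (JL-via-F n k) ⟩
    (+ 2 * b₂ - b₁) - (+ 2 * + F (2 ℕ.+ n) k - + F (1 ℕ.+ n) k)
  ≡⟨ cong₂ (λ a₂ a₁ → (+ 2 * b₂ - b₁) - (+ 2 * a₂ - a₁))
           (F-via-next-level (2 ℕ.+ n) k) (F-via-next-level (1 ℕ.+ n) k) ⟩
    (+ 2 * b₂ - b₁) - (+ 2 * (b₄ - b₃ - b₂) - (b₃ - b₂ - b₁))
  ≡⟨ collect b₁ b₂ b₃ b₄ ⟩
    δ b₁ b₂ b₃ b₄
  ∎
  where
  b₁ b₂ b₃ b₄ : ℤ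
  b₁ = + F (1 ℕ.+ n) (ℕ.suc k)
  b₂ = + F (2 ℕ.+ n) (ℕ.suc k)
  b₃ = + F (3 ℕ.+ n) (ℕ.suc k)
  b₄ = + F (4 ℕ.+ n) (ℕ.suc k)
  collect : ∀ b₁ b₂ b₃ b₄ → (+ 2 * b₂ - b₁) - (+ 2 * (b₄ - b₃ - b₂) - (b₃ - b₂ - b₁)) ≡ δ b₁ b₂ b₃ b₄
  collect = solve-∀

residual : ℤ → ℤ → ℤ → ℤ → ℤ → ℤ
residual m k u₂ u₁ u₀ = (m - + 2 * k) * u₂ - ((m - k) * u₁ + m * u₀)
{-# INLINE residual #-}

pascal-preserves-recurrence : ∀ m k x₀ x₁ {x₂ x₃ x₄} y₀ y₁ y₂ →
  x₂ ≡ x₁ + (y₀ + x₀) → x₃ ≡ x₂ + (y₁ + x₁) → x₄ ≡ x₃ + (y₂ + x₂) →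
  residual (+ 1 + m) (+ 1 + k) x₃ x₂ x₁ ≡ + 0 → residual m k y₂ y₁ y₀ ≡ + 0 →
  residual m (+ 1 + k) x₂ x₁ x₀ ≡ + 0 →
  residual (+ 2 + m) (+ 1 + k) x₄ x₃ x₂ ≡ + 0
pascal-preserves-recurrence m k x₀ x₁ y₀ y₁ y₂ refl refl refl r₁ r₂ r₃ =
  trans (residual-pascal m k x₀ x₁ y₀ y₁ y₂) (cong₂ _+_ r₁ (cong₂ _+_ r₂ r₃))
  where
  residual-pascal : ∀ m k x₀ x₁ y₀ y₁ y₂ →
    let x₂ = x₁ + (y₀ + x₀)
        x₃ = x₂ + (y₁ + x₁)
        x₄ = x₃ + (y₂ + x₂)
    in residual (+ 2 + m) (+ 1 + k) x₄ x₃ x₂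
       ≡ residual (+ 1 + m) (+ 1 + k) x₃ x₂ x₁ + (residual m k y₂ y₁ y₀ + residual m (+ 1 + k) x₂ x₁ x₀)
  residual-pascal = solve-∀

residual-of-zeros : ∀ m k → residual m k (+ 0) (+ 0) (+ 0) ≡ + 0
residual-of-zeros = solve-∀

F-recurrence : ∀ n k → residual (+ 2 + + n) (+ k) (+ F (2 ℕ.+ n) k) (+ F (1 ℕ.+ n) k) (+ F n k) ≡ + 0
F-recurrence n ℕ.zero = begin
    residual M (+ 0) (+ F (2 ℕ.+ n) 0) (+ F (1 ℕ.+ n) 0) (+ F n 0)
  ≡⟨ cong (λ a → residual M (+ 0) a (+ F (1 ℕ.+ n) 0) (+ F n 0)) (cong +_ (F-pascal-zero n)) ⟩
    residual M (+ 0) (+ F (1 ℕ.+ n) 0 + + F n 0) (+ F (1 ℕ.+ n) 0) (+ F n 0)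
  ≡⟨ fibonacci M (+ F (1 ℕ.+ n) 0) (+ F n 0) ⟩
    + 0
  ∎
  where
  M : ℤ
  M = + 2 + + n
  fibonacci : ∀ m x y → residual m (+ 0) (x + y) x y ≡ + 0
  fibonacci = solve-∀
F-recurrence 0 1 = refl
F-recurrence 1 1 = refl
-- For k ≥ 2 all three values are 0 by computation: F_0, …, F_3 have degree at most 1.
F-recurrence 0 (ℕ.suc (ℕ.suc k)) = residual-of-zeros (+ 2) (+ (2 ℕ.+ k))
F-recurrence 1 (ℕ.suc (ℕ.suc k)) = residual-of-zeros (+ 3) (+ (2 ℕ.+ k))
F-recurrence (ℕ.suc (ℕ.suc n)) (ℕ.suc k) =
  pascal-preserves-recurrence (+ 2 + + n) (+ k) (x 0) (x 1) (y 0) (y 1) (y 2)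
  (cong +_ (F-pascal-suc n k)) (cong +_ (F-pascal-suc (1 ℕ.+ n) k)) (cong +_ (F-pascal-suc (2 ℕ.+ n) k))
  (F-recurrence (ℕ.suc n) (ℕ.suc k)) (F-recurrence n k) (F-recurrence n (ℕ.suc k))
  where
  x y : ℕ → ℤ
  x i = + F (i ℕ.+ n) (ℕ.suc k)
  y i = + F (i ℕ.+ n) k

d₀ d₁ d₂ : ℤ → ℤ → ℤ
d₀ N K = (+ 1 + N) * (+ 2 + N) * (N - + 2 - + 6 * K) * (N - + 3 * K)
d₁ N K = (+ 2 + N) * (+ 3 + + 12 * K + + 3 * K * K - + 18 * K * K * K + + 8 * K * N + + 27 * K * K * N
                       - + 2 * N * N - + 10 * K * N * N + N * N * N)
d₂ N K = - ((+ 1 + N) * (N - + 3 - + 6 * K) * (N - + 1 - + 3 * K) * (N + + 2 - + 2 * K))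
{-# INLINE d₀ #-}
{-# INLINE d₁ #-}
{-# INLINE d₂ #-}

-- μ₄, μ₃, μ₂, μ₁ are found in turn by matching the coefficients of b₆, b₅, b₄, b₃ in elimination below.
μ₁ μ₂ μ₃ μ₄ : ℤ → ℤ → ℤ
μ₁ n k = + 2 * (+ 4 + n) * (n - + 6 * k) * (n + + 2 - + 3 * k)
μ₂ n k = + 6 + + 132 * k - + 144 * k * k - + 18 * n + + 117 * n * k - + 54 * n * k * k
         - + 15 * n * n + + 27 * n * n * k - + 3 * n * n * n
μ₃ n k = - + 6 + + 30 * k - + 180 * k * k - + 9 * n + + 99 * n * k - + 54 * n * k * k
         - + 12 * n * n + + 27 * n * n * k - + 3 * n * n * n
μ₄ n k = + 2 * (+ 3 + n) * (n - + 1 - + 6 * k) * (n + + 1 - + 3 * k)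
{-# INLINE μ₁ #-}
{-# INLINE μ₂ #-}
{-# INLINE μ₃ #-}
{-# INLINE μ₄ #-}

δ-recurrence : ∀ n k b₁ b₂ b₃ b₄ b₅ b₆ →
  residual (+ 3 + n) (+ 1 + k) b₃ b₂ b₁ ≡ + 0 → residual (+ 4 + n) (+ 1 + k) b₄ b₃ b₂ ≡ + 0 →
  residual (+ 5 + n) (+ 1 + k) b₅ b₄ b₃ ≡ + 0 → residual (+ 6 + n) (+ 1 + k) b₆ b₅ b₄ ≡ + 0 →
  d₀ (+ 2 + n) k * δ b₁ b₂ b₃ b₄ + d₁ (+ 2 + n) k * δ b₂ b₃ b₄ b₅ + d₂ (+ 2 + n) k * δ b₃ b₄ b₅ b₆ ≡ + 0
δ-recurrence n k b₁ b₂ b₃ b₄ b₅ b₆ r₃ r₄ r₅ r₆ = trans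
  (elimination n k b₁ b₂ b₃ b₄ b₅ b₆)
  (weighted-sum-of-zeros (μ₁ n k) (μ₂ n k) (μ₃ n k) (μ₄ n k) r₃ r₄ r₅ r₆)
  where
  elimination : ∀ n k b₁ b₂ b₃ b₄ b₅ b₆ →
    d₀ (+ 2 + n) k * δ b₁ b₂ b₃ b₄ + d₁ (+ 2 + n) k * δ b₂ b₃ b₄ b₅ + d₂ (+ 2 + n) k * δ b₃ b₄ b₅ b₆
    ≡ μ₁ n k * residual (+ 3 + n) (+ 1 + k) b₃ b₂ b₁ + μ₂ n k * residual (+ 4 + n) (+ 1 + k) b₄ b₃ b₂
    + μ₃ n k * residual (+ 5 + n) (+ 1 + k) b₅ b₄ b₃ + μ₄ n k * residual (+ 6 + n) (+ 1 + k) b₆ b₅ b₄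
  elimination = solve-∀
  weighted-sum-of-zeros : ∀ μ₁ μ₂ μ₃ μ₄ {r₁ r₂ r₃ r₄} → r₁ ≡ + 0 → r₂ ≡ + 0 → r₃ ≡ + 0 → r₄ ≡ + 0 →
    μ₁ * r₁ + μ₂ * r₂ + μ₃ * r₃ + μ₄ * r₄ ≡ + 0
  weighted-sum-of-zeros μ₁ μ₂ μ₃ μ₄ refl refl refl refl = zeros μ₁ μ₂ μ₃ μ₄
    where
    zeros : ∀ a b c d → a * + 0 + b * + 0 + c * + 0 + d * + 0 ≡ + 0
    zeros = solve-∀

lemma3p2 : (n k : ℕ) → 1 ≤ n → 1 ≤ k → 2 Data.Nat.* k ≤ n →
    let N = + n
        K = + k
        d₀ = (+ 1 + N) * (+ 2 + N) * (N - + 2 - + 6 * K) * (N - + 3 * K)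
        d₁ = (+ 2 + N) * (+ 3 + + 12 * K + + 3 * K * K - + 18 * K * K * K + + 8 * K * N + + 27 * K * K * N - + 2 * N * N - + 10 * K * N * N + N * N * N)
        d₂ = - ((+ 1 + N) * (N - + 3 - + 6 * K) * (N - + 1 - + 3 * K) * (N + + 2 - + 2 * K))
    in d₀ * Δ n k + d₁ * Δ (Data.Nat.suc n) k + d₂ * Δ (Data.Nat.suc (Data.Nat.suc n)) k ≡ + 0
lemma3p2 0 k () _ _
lemma3p2 1 k _ 1≤k 2k≤1 = contradiction (≤-trans (*-monoʳ-≤ 2 1≤k) 2k≤1) λ { (ℕ.s≤s ()) }
lemma3p2 (ℕ.suc (ℕ.suc n)) k _ _ _ = begin
    d₀ N K * Δ (2 ℕ.+ n) k + d₁ N K * Δ (3 ℕ.+ n) k + d₂ N K * Δ (4 ℕ.+ n) k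
  ≡⟨ cong₂ _+_ (cong₂ _+_ (cong (d₀ N K *_) (Δ-via-F n k)) (cong (d₁ N K *_) (Δ-via-F (1 ℕ.+ n) k)))
               (cong (d₂ N K *_) (Δ-via-F (2 ℕ.+ n) k)) ⟩
    d₀ N K * δ (b 1) (b 2) (b 3) (b 4) + d₁ N K * δ (b 2) (b 3) (b 4) (b 5) + d₂ N K * δ (b 3) (b 4) (b 5) (b 6)
  ≡⟨ δ-recurrence (+ n) K (b 1) (b 2) (b 3) (b 4) (b 5) (b 6)
       (F-recurrence (1 ℕ.+ n) (ℕ.suc k)) (F-recurrence (2 ℕ.+ n) (ℕ.suc k))
       (F-recurrence (3 ℕ.+ n) (ℕ.suc k)) (F-recurrence (4 ℕ.+ n) (ℕ.suc k)) ⟩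
    + 0
  ∎
  where
  N K : ℤ
  N = + (2 ℕ.+ n)
  K = + k
  b : ℕ → ℤ
  b i = + F (i ℕ.+ n) (ℕ.suc k)
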